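{- Let $K$ be a class of algebras of type $\tau$. Then: 1) $\mathbf{D}\mathbf{S}(K)\subseteq\mathbf{S}\mathbf{D}(K)$; 2) $\mathbf{D}\mathbf{P}(K)\subseteq\mathbf{P}\mathbf{D}(K)$; 3) $\mathbf{D}\mathbf{P_\omega}(K)\subseteq\mathbf{P_\omega}\mathbf{D}(K)$; 4) $\mathbf{D}\mathbf{P_s}(K)\subseteq\mathbf{P_s}\mathbf{D}(K)$; 5) $\mathbf{D}\mathbf{P_r}(K)\subseteq\mathbf{P_r}\mathbf{D}(K)$; 6) $\mathbf{D}\mathbf{P_u}(K)\subseteq\mathbf{P_u}\mathbf{D}(K)$; 7) $\mathbf{D}\mathbf{L}(K)\subseteq\mathbf{L}\mathbf{D}(K)$; 8) $\mathbf{D}\mathbf{L_s}(K)\subseteq\mathbf{L_s}\mathbf{D}(K)$.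
   Context: Fix a type $\tau$ with operation symbols $f_\gamma$ of arity $n_\gamma$. A hypersubstitution $\sigma$ assigns to each $f_\gamma$ a term of type $\tau$ in $n_\gamma$ variables; $\mathbf{A}^\sigma=(A,\sigma(f_\gamma)^{\mathbf{A}})$ is a derived algebra of $\mathbf{A}$, and $\mathbf{D}(K)$ is the class of all derived algebras of algebras in $K$. For a class $K$, $\mathbf{S}(K)$, $\mathbf{P}(K)$, $\mathbf{P_s}(K)$, $\mathbf{P_r}(K)$, $\mathbf{P_u}(K)$, $\mathbf{P_\omega}(K)$ are the classes of algebras isomorphic to subalgebras, direct products, subdirect products, reduced (filtered) products, ultraproducts, and direct products of finite families of algebras from $K$, respectively. A direct spectrum is $\Lambda=(I,\mathbf{A}_i,g_{ij})$ where $(I,\le)$ is up-directed, $\mathbf{A}_i$ are algebras of type $\tau$, and $g_{ij}:\mathbf{A}_i\to\mathbf{A}_j$ ($i\le j$) are homomorphisms with $g_{ii}=\mathrm{id}$ and $g_{jk}g_{ij}=g_{ik}$; its direct limit is $\bigcup_i A_i\times\{i\}/\equiv$, where $(a,i)\equiv(b,j)$ iff $g_{ik}(a)=g_{jk}(b)$ for some $k\ge i,j$, with operations computed in a common upper index. The spectrum is superdirect if all $g_{ij}$ are surjective, and its direct limit is then a superdirect limit. $\mathbf{L}(K)$ and $\mathbf{L_s}(K)$ are the classes of algebras isomorphic to direct limits, resp. superdirect limits, of spectra of algebras from $K$. Composite operators are applied right to left, e.g. $\mathbf{D}\mathbf{S}(K)=\mathbf{D}(\mathbf{S}(K))$. 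-}

module Defs where

open import Level using (Level; _⊔_; Lift; lift; lower) renaming (suc to lsuc)
open import Data.Nat using (ℕ; zero; suc)
open import Data.Fin using (Fin; zero; suc)
open import Data.Product using (Σ; _,_; proj₁; proj₂; _×_)
open import Data.Sum using (_⊎_)
open import Data.Unit using (⊤; tt)
open import Data.Empty using (⊥)
open import Relation.Nullary using (¬_)
open import Relation.Binary.PropositionalEquality using (_≡_)
open import Relation.Binary using (Rel; IsEquivalence)
open import Function using (_∘_)

record Signature : Set₁ where
  field
    Op    : Set
    arity : Op → ℕ
open Signature public

-- Algebras of type τ (carriers are setoids, so that quotients exist)

record Algebra (S : Signature) (ℓ : Level) : Set (lsuc ℓ) where
  field
    Carrier       : Set ℓ
    _≈_           : Rel Carrier ℓ
    isEquivalence : IsEquivalence _≈_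
    ⟦_⟧           : (f : Op S) → (Fin (arity S f) → Carrier) → Carrier
    ⟦⟧-cong       : ∀ f {xs ys : Fin (arity S f) → Carrier} →
                    (∀ t → xs t ≈ ys t) → ⟦ f ⟧ xs ≈ ⟦ f ⟧ ys
  open IsEquivalence isEquivalence public
    renaming (refl to ≈-refl; sym to ≈-sym; trans to ≈-trans)

open Algebra public using (Carrier)


Class : (S : Signature) (ℓ ℓk : Level) → Set (lsuc ℓ ⊔ lsuc ℓk)
Class S ℓ ℓk = Algebra S ℓ → Set ℓk

_⊆ᶜ_ : ∀ {S ℓ ℓ₁ ℓ₂} → (Algebra S ℓ → Set ℓ₁) → (Algebra S ℓ → Set ℓ₂) → Set (lsuc ℓ ⊔ ℓ₁ ⊔ ℓ₂)
X ⊆ᶜ Y = ∀ {B} → X B → Y B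

module _ {S : Signature} {ℓ : Level} where

  record IsHom (A B : Algebra S ℓ) (h : Carrier A → Carrier B) : Set ℓ where
    private
      module A = Algebra A
      module B = Algebra B
    field
      cong      : ∀ {x y} → x A.≈ y → h x B.≈ h y
      preserves : ∀ f (xs : Fin (arity S f) → Carrier A) →
                  h (A.⟦ f ⟧ xs) B.≈ B.⟦ f ⟧ (h ∘ xs)

  record _≅_ (A B : Algebra S ℓ) : Set ℓ where
    private
      module A = Algebra A
      module B = Algebra B
    field
      to         : Carrier A → Carrier B
      isHom      : IsHom A B to
      injective  : ∀ {x y} → to x B.≈ to y → x A.≈ y
      surjective : ∀ y → Σ (Carrier A) λ x → to x B.≈ y

data Term (S : Signature) (n : ℕ) : Set where
  var  : Fin n → Term S n
  node : (f : Op S) → (Fin (arity S f) → Term S n) → Term S n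

module _ {S : Signature} {ℓ : Level} (A : Algebra S ℓ) where
  open Algebra A hiding (Carrier)

  eval : ∀ {n} → Term S n → (Fin n → Carrier A) → Carrier A
  eval (var x)     ρ = ρ x
  eval (node f ts) ρ = ⟦ f ⟧ (λ t → eval (ts t) ρ)

  eval-cong : ∀ {n} (u : Term S n) {ρ ρ' : Fin n → Carrier A} →
              (∀ x → ρ x ≈ ρ' x) → eval u ρ ≈ eval u ρ'
  eval-cong (var x)     e = e x
  eval-cong (node f ts) e = ⟦⟧-cong f (λ t → eval-cong (ts t) e)

Hypersubstitution : Signature → Set
Hypersubstitution S = (f : Op S) → Term S (arity S f)

_^_ : ∀ {S ℓ} → Algebra S ℓ → Hypersubstitution S → Algebra S ℓ
A ^ σ = record
  { Carrier       = Carrier A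
  ; _≈_           = Algebra._≈_ A
  ; isEquivalence = Algebra.isEquivalence A
  ; ⟦_⟧           = λ f xs → eval A (σ f) xs
  ; ⟦⟧-cong       = λ f e → eval-cong A (σ f) e
  }

module _ {S : Signature} {ℓ : Level} (A : Algebra S ℓ) where
  open Algebra A hiding (Carrier)

  Closed : (Carrier A → Set ℓ) → Set ℓ
  Closed P = ∀ f (xs : Fin (arity S f) → Carrier A) → (∀ t → P (xs t)) → P (⟦ f ⟧ xs)

  Sub : (P : Carrier A → Set ℓ) → Closed P → Algebra S ℓ
  Sub P cl = record
    { Carrier       = Σ (Carrier A) P
    ; _≈_           = λ x y → proj₁ x ≈ proj₁ y
    ; isEquivalence = record { refl = ≈-refl ; sym = ≈-sym ; trans = ≈-trans }
    ; ⟦_⟧           = λ f xs → ⟦ f ⟧ (proj₁ ∘ xs) , cl f (proj₁ ∘ xs) (proj₂ ∘ xs)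
    ; ⟦⟧-cong       = λ f e → ⟦⟧-cong f e
    }

Π : ∀ {S ℓ} {I : Set ℓ} → (I → Algebra S ℓ) → Algebra S ℓ
Π {S} {ℓ} {I} A = record
  { Carrier       = (i : I) → Carrier (A i)
  ; _≈_           = λ x y → ∀ i → Algebra._≈_ (A i) (x i) (y i)
  ; isEquivalence = record
      { refl  = λ i → Algebra.≈-refl (A i)
      ; sym   = λ e i → Algebra.≈-sym (A i) (e i)
      ; trans = λ e e' i → Algebra.≈-trans (A i) (e i) (e' i) }
  ; ⟦_⟧           = λ f xs i → Algebra.⟦_⟧ (A i) f (λ t → xs t i)
  ; ⟦⟧-cong       = λ f e i → Algebra.⟦⟧-cong (A i) f (λ t → e t i)
  }

module _ {ℓ : Level} {I : Set ℓ} where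

  record IsFilter (F : (I → Set ℓ) → Set ℓ) : Set (lsuc ℓ) where
    field
      full : F (λ _ → Lift ℓ ⊤)
      up   : ∀ {X Y : I → Set ℓ} → (∀ i → X i → Y i) → F X → F Y
      meet : ∀ {X Y : I → Set ℓ} → F X → F Y → F (λ i → X i × Y i)

  record IsUltrafilter (F : (I → Set ℓ) → Set ℓ) : Set (lsuc ℓ) where
    field
      isFilter : IsFilter F
      proper   : ¬ F (λ _ → Lift ℓ ⊥)
      ultra    : ∀ (X : I → Set ℓ) → F X ⊎ F (λ i → ¬ X i)

  module _ {F : (I → Set ℓ) → Set ℓ} (isF : IsFilter F) where
    open IsFilter isF

    meetFin : ∀ n (X : Fin n → I → Set ℓ) → (∀ t → F (X t)) → F (λ i → ∀ t → X t i)
    meetFin zero    X h = up (λ i _ ()) full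
    meetFin (suc n) X h =
      up (λ i p → λ { zero → proj₁ p ; (suc t) → proj₂ p t })
         (meet (h zero) (meetFin n (X ∘ suc) (h ∘ suc)))

ΠF : ∀ {S ℓ} {I : Set ℓ} → (I → Algebra S ℓ) →
     (F : (I → Set ℓ) → Set ℓ) → IsFilter F → Algebra S ℓ
ΠF {S} {ℓ} {I} A F isF = record
  { Carrier       = (i : I) → Carrier (A i)
  ; _≈_           = λ x y → F (λ i → Algebra._≈_ (A i) (x i) (y i))
  ; isEquivalence = record
      { refl  = up (λ i _ → Algebra.≈-refl (A i)) full
      ; sym   = up (λ i e → Algebra.≈-sym (A i) e)
      ; trans = λ e e' → up (λ i p → Algebra.≈-trans (A i) (proj₁ p) (proj₂ p)) (meet e e') }
  ; ⟦_⟧           = λ f xs i → Algebra.⟦_⟧ (A i) f (λ t → xs t i)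
  ; ⟦⟧-cong       = λ f {xs} {ys} e →
      up (λ i p → Algebra.⟦⟧-cong (A i) f p)
         (meetFin isF (arity S f) (λ t i → Algebra._≈_ (A i) (xs t i) (ys t i)) e)
  }
  where open IsFilter isF

record DirectSpectrum (S : Signature) (ℓ : Level) : Set (lsuc ℓ) where
  field
    I         : Set ℓ
    _≤_       : I → I → Set ℓ
    ≤-refl    : ∀ {i} → i ≤ i
    ≤-trans   : ∀ {i j k} → i ≤ j → j ≤ k → i ≤ k
    ≤-antisym : ∀ {i j} → i ≤ j → j ≤ i → i ≡ j
    -- up-directed (a directed set is nonempty)
    inhabited : I
    directed  : ∀ i j → Σ I λ k → i ≤ k × j ≤ k
    A         : I → Algebra S ℓ
    g         : ∀ {i j} → i ≤ j → Carrier (A i) → Carrier (A j)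
    g-hom     : ∀ {i j} (p : i ≤ j) → IsHom (A i) (A j) (g p)
    g-id      : ∀ {i} (p : i ≤ i) x → Algebra._≈_ (A i) (g p x) x
    g-comp    : ∀ {i j k} (p : i ≤ j) (q : j ≤ k) (r : i ≤ k) x →
                Algebra._≈_ (A k) (g r x) (g q (g p x))

IsSuperdirect : ∀ {S ℓ} → DirectSpectrum S ℓ → Set ℓ
IsSuperdirect Λ = ∀ {i j} (p : i ≤ j) (y : Carrier (A j)) →
                  Σ (Carrier (A i)) λ x → Algebra._≈_ (A j) (g p x) y
  where open DirectSpectrum Λ

module Limit {S : Signature} {ℓ : Level} (Λ : DirectSpectrum S ℓ) where
  open DirectSpectrum Λ

  private
    Eq : ∀ i → Carrier (A i) → Carrier (A i) → Set ℓ
    Eq i = Algebra._≈_ (A i)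
    rf : ∀ {i} {x} → Eq i x x
    rf {i} = Algebra.≈-refl (A i)
    sy : ∀ {i} {x y} → Eq i x y → Eq i y x
    sy {i} = Algebra.≈-sym (A i)
    tr : ∀ {i} {x y z} → Eq i x y → Eq i y z → Eq i x z
    tr {i} = Algebra.≈-trans (A i)

  Elt : Set ℓ
  Elt = Σ I (λ i → Carrier (A i))

  _∼_ : Elt → Elt → Set ℓ
  (i , a) ∼ (j , b) = Σ I λ k → Σ (i ≤ k) λ p → Σ (j ≤ k) λ q → Eq k (g p a) (g q b)

  ub : ∀ {n} (is : Fin n → I) → Σ I λ k → ∀ t → is t ≤ k
  ub {zero}  is = inhabited , λ ()
  ub {suc n} is with ub (is ∘ suc) | directed (is zero) (proj₁ (ub (is ∘ suc)))
  ... | k , ps | m , p , q = m , λ { zero → p ; (suc t) → ≤-trans (ps t) q }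

  lift∼ : ∀ {i j a b} ((k , p , q , e) : (i , a) ∼ (j , b)) {M} (u : k ≤ M)
          (r : i ≤ M) (s : j ≤ M) → Eq M (g r a) (g s b)
  lift∼ (k , p , q , e) u r s =
    tr (g-comp p u r _) (tr (IsHom.cong (g-hom u) e) (sy (g-comp q u s _)))

  ∼-refl : ∀ {x} → x ∼ x
  ∼-refl {i , a} = i , ≤-refl , ≤-refl , rf

  ∼-sym : ∀ {x y} → x ∼ y → y ∼ x
  ∼-sym (k , p , q , e) = k , q , p , sy e

  ∼-trans : ∀ {x y z} → x ∼ y → y ∼ z → x ∼ z
  ∼-trans {i , a} {j , b} {l , c} w₁@(k₁ , p₁ , q₁ , e₁) w₂@(k₂ , p₂ , q₂ , e₂)
    with directed k₁ k₂
  ... | M , u₁ , u₂ =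
    M , ≤-trans p₁ u₁ , ≤-trans q₂ u₂ ,
    tr (lift∼ w₁ u₁ (≤-trans p₁ u₁) (≤-trans q₁ u₁))
       (lift∼ w₂ u₂ (≤-trans q₁ u₁) (≤-trans q₂ u₂))

  op : (f : Op S) → (Fin (arity S f) → Elt) → Elt
  op f xs = proj₁ (ub (proj₁ ∘ xs)) ,
            Algebra.⟦_⟧ (A (proj₁ (ub (proj₁ ∘ xs)))) f
              (λ t → g (proj₂ (ub (proj₁ ∘ xs)) t) (proj₂ (xs t)))

  op-up : ∀ f (xs : Fin (arity S f) → Elt) {M} (u : proj₁ (op f xs) ≤ M)
          (rs : ∀ t → proj₁ (xs t) ≤ M) →
          Eq M (g u (proj₂ (op f xs))) (Algebra.⟦_⟧ (A M) f (λ t → g (rs t) (proj₂ (xs t))))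
  op-up f xs {M} u rs =
    tr (IsHom.preserves (g-hom u) f _)
       (Algebra.⟦⟧-cong (A M) f (λ t → sy (g-comp _ u (rs t) _)))

  op-cong : ∀ f {xs ys : Fin (arity S f) → Elt} → (∀ t → xs t ∼ ys t) → op f xs ∼ op f ys
  op-cong f {xs} {ys} es
    with ub (λ t → proj₁ (es t))
       | directed (proj₁ (op f xs)) (proj₁ (op f ys))
  ... | K , ms | N , a , b with directed N K
  ... | M , c , d =
    M , ≤-trans a c , ≤-trans b c ,
    tr (op-up f xs (≤-trans a c) (λ t → ≤-trans (proj₁ (proj₂ (es t))) (≤-trans (ms t) d)))
       (tr (Algebra.⟦⟧-cong (A M) f
              (λ t → lift∼ (es t) (≤-trans (ms t) d) _ _))
           (sy (op-up f ys (≤-trans b c)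
                  (λ t → ≤-trans (proj₁ (proj₂ (proj₂ (es t)))) (≤-trans (ms t) d)))))

  lim : Algebra S ℓ
  lim = record
    { Carrier       = Elt
    ; _≈_           = _∼_
    ; isEquivalence = record { refl = ∼-refl ; sym = ∼-sym ; trans = ∼-trans }
    ; ⟦_⟧           = op
    ; ⟦⟧-cong       = op-cong
    }

open Limit public using (lim)

-- Class operators (each result is closed under isomorphism)

module _ {S : Signature} {ℓ : Level} where

  𝐃 : ∀ {ℓk} → (Algebra S ℓ → Set ℓk) → Algebra S ℓ → Set (lsuc ℓ ⊔ ℓk)
  𝐃 K B = Σ (Algebra S ℓ) λ A → Σ (Hypersubstitution S) λ σ → K A × (B ≅ (A ^ σ))

  𝐒 : ∀ {ℓk} → (Algebra S ℓ → Set ℓk) → Algebra S ℓ → Set (lsuc ℓ ⊔ ℓk)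
  𝐒 K B = Σ (Algebra S ℓ) λ A → K A ×
          (Σ (Carrier A → Set ℓ) λ P → Σ (Closed A P) λ cl → B ≅ Sub A P cl)

  𝐏 : ∀ {ℓk} → (Algebra S ℓ → Set ℓk) → Algebra S ℓ → Set (lsuc ℓ ⊔ ℓk)
  𝐏 K B = Σ (Set ℓ) λ I → Σ (I → Algebra S ℓ) λ A → (∀ i → K (A i)) × (B ≅ Π A)

  𝐏ω : ∀ {ℓk} → (Algebra S ℓ → Set ℓk) → Algebra S ℓ → Set (lsuc ℓ ⊔ ℓk)
  𝐏ω K B = Σ ℕ λ n → Σ (Lift ℓ (Fin n) → Algebra S ℓ) λ A →
           (∀ i → K (A i)) × (B ≅ Π A)

  𝐏s : ∀ {ℓk} → (Algebra S ℓ → Set ℓk) → Algebra S ℓ → Set (lsuc ℓ ⊔ ℓk)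
  𝐏s K B = Σ (Set ℓ) λ I → Σ (I → Algebra S ℓ) λ A → (∀ i → K (A i)) ×
           (Σ (Carrier (Π A) → Set ℓ) λ P → Σ (Closed (Π A) P) λ cl →
             (∀ i (a : Carrier (A i)) → Σ (Carrier (Π A)) λ x →
                P x × Algebra._≈_ (A i) (x i) a)
             × (B ≅ Sub (Π A) P cl))

  𝐏r : ∀ {ℓk} → (Algebra S ℓ → Set ℓk) → Algebra S ℓ → Set (lsuc ℓ ⊔ ℓk)
  𝐏r K B = Σ (Set ℓ) λ I → Σ (I → Algebra S ℓ) λ A → (∀ i → K (A i)) ×
           (Σ ((I → Set ℓ) → Set ℓ) λ F → Σ (IsFilter F) λ isF → B ≅ ΠF A F isF)

  𝐏u : ∀ {ℓk} → (Algebra S ℓ → Set ℓk) → Algebra S ℓ → Set (lsuc ℓ ⊔ ℓk)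
  𝐏u K B = Σ (Set ℓ) λ I → Σ (I → Algebra S ℓ) λ A → (∀ i → K (A i)) ×
           (Σ ((I → Set ℓ) → Set ℓ) λ F → Σ (IsUltrafilter F) λ isU →
             B ≅ ΠF A F (IsUltrafilter.isFilter isU))

  𝐋 : ∀ {ℓk} → (Algebra S ℓ → Set ℓk) → Algebra S ℓ → Set (lsuc ℓ ⊔ ℓk)
  𝐋 K B = Σ (DirectSpectrum S ℓ) λ Λ →
          (∀ i → K (DirectSpectrum.A Λ i)) × (B ≅ lim Λ)

  𝐋s : ∀ {ℓk} → (Algebra S ℓ → Set ℓk) → Algebra S ℓ → Set (lsuc ℓ ⊔ ℓk)
  𝐋s K B = Σ (DirectSpectrum S ℓ) λ Λ → IsSuperdirect Λ ×
           (∀ i → K (DirectSpectrum.A Λ i)) × (B ≅ lim Λ)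

-- Passing to a derived algebra A ^ σ keeps the carrier and the equality and replaces each
-- fundamental operation by a term operation.  Every construction in question (subalgebras,
-- direct, subdirect, reduced and ultra products, direct limits) computes its operations
-- coordinatewise or in a common upper index, through maps that are homomorphisms, and
-- homomorphisms commute with term operations.  Hence performing the construction and then
-- passing to the derived algebra gives, up to isomorphism, the same construction performed
-- on the derived factors, and those lie in 𝐃 K.
module Submission where

open import Defs
open import Level using (Level)
open import Data.Fin using (Fin)
open import Data.Product using (_×_; Σ; _,_; proj₁; proj₂)
open import Function using (_∘_)

module _ {S : Signature} {ℓ : Level} where

  open Algebra using (_≈_; ≈-refl; ≈-sym; ≈-trans; ⟦⟧-cong)

  ≅-refl : {A : Algebra S ℓ} → A ≅ A
  ≅-refl {A} = record
    { to         = λ x → x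
    ; isHom      = record { cong = λ e → e ; preserves = λ _ _ → ≈-refl A }
    ; injective  = λ e → e
    ; surjective = λ y → y , ≈-refl A
    }

  ≅-trans : {A B C : Algebra S ℓ} → A ≅ B → B ≅ C → A ≅ C
  ≅-trans {C = C} A≅B B≅C = record
    { to         = J.to ∘ I.to
    ; isHom      = record
        { cong      = J.cong ∘ I.cong
        ; preserves = λ f xs → ≈-trans C (J.cong (I.preserves f xs)) (J.preserves f _)
        }
    ; injective  = I.injective ∘ J.injective
    ; surjective = λ z →
        let (y , Jy≈z) = J.surjective z
            (x , Ix≈y) = I.surjective y
        in  x , ≈-trans C (J.cong Ix≈y) Jy≈z
    }
    where
    module I where
      open _≅_ A≅B public
      open IsHom isHom public
    module J where
      open _≅_ B≅C public
      open IsHom isHom public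

  IsHom-eval : {A B : Algebra S ℓ} {h : Carrier A → Carrier B} → IsHom A B h →
               ∀ {n} (u : Term S n) (ρ : Fin n → Carrier A) →
               _≈_ B (h (eval A u ρ)) (eval B u (h ∘ ρ))
  IsHom-eval {B = B} h-hom (var x)     ρ = ≈-refl B
  IsHom-eval {B = B} h-hom (node f ts) ρ =
    ≈-trans B (IsHom.preserves h-hom f _) (⟦⟧-cong B f λ t → IsHom-eval h-hom (ts t) ρ)

  IsHom-^ : {A B : Algebra S ℓ} {h : Carrier A → Carrier B} (σ : Hypersubstitution S) →
            IsHom A B h → IsHom (A ^ σ) (B ^ σ) h
  IsHom-^ σ h-hom = record
    { cong      = IsHom.cong h-hom
    ; preserves = λ f → IsHom-eval h-hom (σ f)
    }

  ≅-^ : {A B : Algebra S ℓ} (σ : Hypersubstitution S) → A ≅ B → (A ^ σ) ≅ (B ^ σ)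
  ≅-^ σ A≅B = record
    { to         = to
    ; isHom      = IsHom-^ σ isHom
    ; injective  = injective
    ; surjective = surjective
    }
    where open _≅_ A≅B

  ^-≅-via : {A B X Y : Algebra S ℓ} (σ : Hypersubstitution S) →
            B ≅ (A ^ σ) → A ≅ X → (X ^ σ) ≅ Y → B ≅ Y
  ^-≅-via σ B≅A^σ A≅X X^σ≅Y = ≅-trans B≅A^σ (≅-trans (≅-^ σ A≅X) X^σ≅Y)

  ^-∈𝐃 : ∀ {ℓk} {K : Algebra S ℓ → Set ℓk} {A : Algebra S ℓ} (σ : Hypersubstitution S) →
         K A → 𝐃 K (A ^ σ)
  ^-∈𝐃 {A = A} σ A∈K = A , σ , A∈K , ≅-refl

  Closed-eval : (A : Algebra S ℓ) (P : Carrier A → Set ℓ) → Closed A P →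
                ∀ {n} (u : Term S n) (ρ : Fin n → Carrier A) →
                (∀ t → P (ρ t)) → P (eval A u ρ)
  Closed-eval A P cl (var x)     ρ Pρ = Pρ x
  Closed-eval A P cl (node f ts) ρ Pρ = cl f _ λ t → Closed-eval A P cl (ts t) ρ Pρ

  Closed-^ : (A : Algebra S ℓ) (P : Carrier A → Set ℓ) (σ : Hypersubstitution S) →
             Closed A P → Closed (A ^ σ) P
  Closed-^ A P σ cl f = Closed-eval A P cl (σ f)

  Sub-^ : (A : Algebra S ℓ) (P : Carrier A → Set ℓ) (cl : Closed A P)
          (σ : Hypersubstitution S) → (Sub A P cl ^ σ) ≅ Sub (A ^ σ) P (Closed-^ A P σ cl)
  Sub-^ A P cl σ = record
    { to         = λ x → x
    ; isHom      = record
        { cong      = λ e → e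
        ; preserves = λ f → IsHom-eval proj₁-hom (σ f)
        }
    ; injective  = λ e → e
    ; surjective = λ y → y , ≈-refl A
    }
    where
    proj₁-hom : IsHom (Sub A P cl) A proj₁
    proj₁-hom = record { cong = λ e → e ; preserves = λ _ _ → ≈-refl A }

  module _ {A B : Algebra S ℓ} (A≅B : A ≅ B) (P : Carrier A → Set ℓ) where
    open _≅_ A≅B
    open IsHom isHom

    Image : Carrier B → Set ℓ
    Image y = Σ (Carrier A) λ x → P x × _≈_ B (to x) y

    Closed-Image : Closed A P → Closed B Image
    Closed-Image cl f ys Image-ys =
      Algebra.⟦_⟧ A f xs , cl f xs (proj₁ ∘ proj₂ ∘ Image-ys) ,
      ≈-trans B (preserves f xs) (⟦⟧-cong B f (proj₂ ∘ proj₂ ∘ Image-ys))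
      where
      xs : Fin (arity S f) → Carrier A
      xs = proj₁ ∘ Image-ys

    Sub-Image : (cl : Closed A P) → Sub A P cl ≅ Sub B Image (Closed-Image cl)
    Sub-Image cl = record
      { to         = λ (x , Px) → to x , x , Px , ≈-refl B
      ; isHom      = record { cong = cong ; preserves = λ f xs → preserves f (proj₁ ∘ xs) }
      ; injective  = injective
      ; surjective = λ (y , x , Px , x↦y) → (x , Px) , x↦y
      }

  Π-eval : {I : Set ℓ} (A : I → Algebra S ℓ) → ∀ {n} (u : Term S n)
           (ρ : Fin n → Carrier (Π A)) (i : I) →
           _≈_ (A i) (eval (Π A) u ρ i) (eval (A i) u (λ t → ρ t i))
  Π-eval A (var x)     ρ i = ≈-refl (A i)
  Π-eval A (node f ts) ρ i = ⟦⟧-cong (A i) f λ t → Π-eval A (ts t) ρ i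

  Π-^ : {I : Set ℓ} (A : I → Algebra S ℓ) (σ : Hypersubstitution S) →
        (Π A ^ σ) ≅ Π (λ i → A i ^ σ)
  Π-^ A σ = record
    { to         = λ x → x
    ; isHom      = record { cong = λ e → e ; preserves = λ f xs → Π-eval A (σ f) xs }
    ; injective  = λ e → e
    ; surjective = λ y → y , λ i → ≈-refl (A i)
    }

  ΠF-eval : {I : Set ℓ} (A : I → Algebra S ℓ) {F : (I → Set ℓ) → Set ℓ} (isF : IsFilter F) →
            ∀ {n} (u : Term S n) (ρ : Fin n → Carrier (ΠF A F isF)) (i : I) →
            _≈_ (A i) (eval (ΠF A F isF) u ρ i) (eval (A i) u (λ t → ρ t i))
  ΠF-eval A isF (var x)     ρ i = ≈-refl (A i)
  ΠF-eval A isF (node f ts) ρ i = ⟦⟧-cong (A i) f λ t → ΠF-eval A isF (ts t) ρ i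

  ΠF-^ : {I : Set ℓ} (A : I → Algebra S ℓ) {F : (I → Set ℓ) → Set ℓ} (isF : IsFilter F)
         (σ : Hypersubstitution S) → (ΠF A F isF ^ σ) ≅ ΠF (λ i → A i ^ σ) F isF
  ΠF-^ {I} A {F} isF σ = record
    { to         = λ x → x
    ; isHom      = record
        { cong      = λ e → e
        ; preserves = λ f xs → everywhere λ i → ΠF-eval A isF (σ f) xs i
        }
    ; injective  = λ e → e
    ; surjective = λ y → y , everywhere λ i → ≈-refl (A i)
    }
    where
    open IsFilter isF
    everywhere : {X : I → Set ℓ} → (∀ i → X i) → F X
    everywhere Xi = up (λ i _ → Xi i) full

  _^ˢ_ : DirectSpectrum S ℓ → Hypersubstitution S → DirectSpectrum S ℓ
  Λ ^ˢ σ = record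
    { I = I ; _≤_ = _≤_ ; ≤-refl = ≤-refl ; ≤-trans = ≤-trans ; ≤-antisym = ≤-antisym
    ; inhabited = inhabited ; directed = directed
    ; A = λ i → A i ^ σ ; g = g ; g-hom = λ p → IsHom-^ σ (g-hom p)
    ; g-id = g-id ; g-comp = g-comp
    }
    where open DirectSpectrum Λ

  module _ (Λ : DirectSpectrum S ℓ) where
    open DirectSpectrum Λ
    open Limit Λ using (Elt; _∼_; op; op-up; op-cong; ∼-refl; ∼-trans)

    op-at : ∀ f {k} (xs : Fin (arity S f) → Carrier (A k)) →
            op f (λ t → k , xs t) ∼ (k , Algebra.⟦_⟧ (A k) f xs)
    op-at f {k} xs with directed (proj₁ (op f λ t → k , xs t)) k
    ... | M , u , r =
      M , u , r ,
      ≈-trans (A M) (op-up f (λ t → k , xs t) u λ _ → r)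
                    (≈-sym (A M) (IsHom.preserves (g-hom r) f xs))

    lim-eval : ∀ {n} (u : Term S n) (ρ : Fin n → Elt) k (ρ≤k : ∀ t → proj₁ (ρ t) ≤ k) →
               eval (lim Λ) u ρ ∼ (k , eval (A k) u (λ t → g (ρ≤k t) (proj₂ (ρ t))))
    lim-eval (var x)     ρ k ρ≤k = k , ρ≤k x , ≤-refl , ≈-sym (A k) (g-id ≤-refl _)
    lim-eval (node f ts) ρ k ρ≤k =
      ∼-trans (op-cong f λ t → lim-eval (ts t) ρ k ρ≤k) (op-at f _)

    lim-^ : (σ : Hypersubstitution S) → (lim Λ ^ σ) ≅ lim (Λ ^ˢ σ)
    lim-^ σ = record
      { to         = λ x → x
      ; isHom      = record
          { cong      = λ e → e
          ; preserves = λ f xs → lim-eval (σ f) xs _ (proj₂ (Limit.ub (Λ ^ˢ σ) (proj₁ ∘ xs)))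
          }
      ; injective  = λ e → e
      ; surjective = λ y → y , ∼-refl
      }

module _ {S : Signature} {ℓ ℓk : Level} (K : Algebra S ℓ → Set ℓk) where

  𝐃𝐒⊆𝐒𝐃 : 𝐃 (𝐒 K) ⊆ᶜ 𝐒 (𝐃 K)
  𝐃𝐒⊆𝐒𝐃 (A , σ , (C , C∈K , P , cl , A≅) , B≅) =
    C ^ σ , ^-∈𝐃 σ C∈K , P , Closed-^ C P σ cl , ^-≅-via σ B≅ A≅ (Sub-^ C P cl σ)

  𝐃𝐏⊆𝐏𝐃 : 𝐃 (𝐏 K) ⊆ᶜ 𝐏 (𝐃 K)
  𝐃𝐏⊆𝐏𝐃 (A , σ , (I , C , C∈K , A≅) , B≅) =
    I , (λ i → C i ^ σ) , (λ i → ^-∈𝐃 σ (C∈K i)) , ^-≅-via σ B≅ A≅ (Π-^ C σ)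

  𝐃𝐏ω⊆𝐏ω𝐃 : 𝐃 (𝐏ω K) ⊆ᶜ 𝐏ω (𝐃 K)
  𝐃𝐏ω⊆𝐏ω𝐃 (A , σ , (n , C , C∈K , A≅) , B≅) =
    n , (λ i → C i ^ σ) , (λ i → ^-∈𝐃 σ (C∈K i)) , ^-≅-via σ B≅ A≅ (Π-^ C σ)

  -- P need not respect ≈, while the operations of Π C ^ σ and Π (C ^ σ) agree only up to ≈;
  -- so P is carried over to Π (C ^ σ) as its image under Π-^.
  𝐃𝐏s⊆𝐏s𝐃 : 𝐃 (𝐏s K) ⊆ᶜ 𝐏s (𝐃 K)
  𝐃𝐏s⊆𝐏s𝐃 (A , σ , (I , C , C∈K , P , cl , onto , A≅) , B≅) =
    I , (λ i → C i ^ σ) , (λ i → ^-∈𝐃 σ (C∈K i)) ,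
    Image (Π-^ C σ) P , Closed-Image (Π-^ C σ) P cl′ ,
    (λ i a → let (x , Px , xᵢ≈a) = onto i a
             in  x , (x , Px , λ j → Algebra.≈-refl (C j)) , xᵢ≈a) ,
    ^-≅-via σ B≅ A≅ (≅-trans (Sub-^ (Π C) P cl σ) (Sub-Image (Π-^ C σ) P cl′))
    where
    cl′ : Closed (Π C ^ σ) P
    cl′ = Closed-^ (Π C) P σ cl

  𝐃𝐏r⊆𝐏r𝐃 : 𝐃 (𝐏r K) ⊆ᶜ 𝐏r (𝐃 K)
  𝐃𝐏r⊆𝐏r𝐃 (A , σ , (I , C , C∈K , F , isF , A≅) , B≅) =
    I , (λ i → C i ^ σ) , (λ i → ^-∈𝐃 σ (C∈K i)) , F , isF , ^-≅-via σ B≅ A≅ (ΠF-^ C isF σ)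

  𝐃𝐏u⊆𝐏u𝐃 : 𝐃 (𝐏u K) ⊆ᶜ 𝐏u (𝐃 K)
  𝐃𝐏u⊆𝐏u𝐃 (A , σ , (I , C , C∈K , F , isU , A≅) , B≅) =
    I , (λ i → C i ^ σ) , (λ i → ^-∈𝐃 σ (C∈K i)) , F , isU ,
    ^-≅-via σ B≅ A≅ (ΠF-^ C (IsUltrafilter.isFilter isU) σ)

  𝐃𝐋⊆𝐋𝐃 : 𝐃 (𝐋 K) ⊆ᶜ 𝐋 (𝐃 K)
  𝐃𝐋⊆𝐋𝐃 (A , σ , (Λ , Λ∈K , A≅) , B≅) =
    Λ ^ˢ σ , (λ i → ^-∈𝐃 σ (Λ∈K i)) , ^-≅-via σ B≅ A≅ (lim-^ Λ σ)

  𝐃𝐋s⊆𝐋s𝐃 : 𝐃 (𝐋s K) ⊆ᶜ 𝐋s (𝐃 K)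
  𝐃𝐋s⊆𝐋s𝐃 (A , σ , (Λ , superdirect , Λ∈K , A≅) , B≅) =
    Λ ^ˢ σ , superdirect , (λ i → ^-∈𝐃 σ (Λ∈K i)) , ^-≅-via σ B≅ A≅ (lim-^ Λ σ)

proposition5p3 : (S : Signature) {ℓ ℓk : Level} (K : Algebra S ℓ → Set ℓk) →
    (𝐃 (𝐒 K) ⊆ᶜ 𝐒 (𝐃 K)) ×
    (𝐃 (𝐏 K) ⊆ᶜ 𝐏 (𝐃 K)) ×
    (𝐃 (𝐏ω K) ⊆ᶜ 𝐏ω (𝐃 K)) ×
    (𝐃 (𝐏s K) ⊆ᶜ 𝐏s (𝐃 K)) ×
    (𝐃 (𝐏r K) ⊆ᶜ 𝐏r (𝐃 K)) ×
    (𝐃 (𝐏u K) ⊆ᶜ 𝐏u (𝐃 K)) ×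
    (𝐃 (𝐋 K) ⊆ᶜ 𝐋 (𝐃 K)) ×
    (𝐃 (𝐋s K) ⊆ᶜ 𝐋s (𝐃 K))
proposition5p3 S K =
  𝐃𝐒⊆𝐒𝐃 K , 𝐃𝐏⊆𝐏𝐃 K , 𝐃𝐏ω⊆𝐏ω𝐃 K , 𝐃𝐏s⊆𝐏s𝐃 K ,
  𝐃𝐏r⊆𝐏r𝐃 K , 𝐃𝐏u⊆𝐏u𝐃 K , 𝐃𝐋⊆𝐋𝐃 K , 𝐃𝐋s⊆𝐋s𝐃 K
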